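{- Let $n$ be an integer with $2^{20} < n \leq 10^{16}$, and suppose $n = p_1 p_2 \cdots p_k$ is square-free, where $p_1, \dots, p_k$ are distinct primes. Then $$\sum_{j=1}^{k} \left(\lfloor \log_2 p_j \rfloor \,|\, 1\right) \;\geq\; \lfloor \log_2 n \rfloor - 7,$$ and, if moreover $p_k > \sqrt{n}$, then $$\sum_{j=1}^{k-1} \left(\lfloor \log_2 p_j \rfloor \,|\, 1\right) \;<\; \lfloor \log_2 n \rfloor - 7.$$
   Context: For a nonnegative integer $m$, $m \,|\, 1$ denotes the bitwise OR of $m$ with $1$; that is, $m\,|\,1 = m$ if $m$ is odd and $m\,|\,1 = m+1$ if $m$ is even. -}

module Defs where

open import Data.Nat using (ℕ; suc; _%_)
open import Data.Nat.Logarithm using (⌊log₂_⌋)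
open import Data.List using (List; map)
open import Data.Nat.ListAction using (sum)

-- m | 1 : bitwise OR of m with 1 (m if m odd, m+1 if m even)
_∣∣1 : ℕ → ℕ
m ∣∣1 with m % 2
... | 0 = suc m
... | _ = m

S : List ℕ → ℕ
S ps = sum (map (λ p → ⌊log₂ p ⌋ ∣∣1) ps)

-- Write w(p) = ⌊log₂ p⌋ | 1, so 2^S = ∏ 2^w(p). Since 2^⌊log₂ p⌋ ≤ p < 2^(⌊log₂ p⌋+1)
-- and ⌊log₂ p⌋ ≤ w(p) ≤ ⌊log₂ p⌋ + 1, one gets p^7 ≤ 2^(8w(p)) as soon as
-- ⌊log₂ p⌋ ≥ 7 and 2^(5w(p)) ≤ p^6 as soon as ⌊log₂ p⌋ ≥ 5; the finitely many
-- small primes violating these are exceptions whose total defect is a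
-- constant. Multiplying over the distinct prime factors gives
-- n^7 ≤ 2^(8S) · c₁, which with n ≤ 10^16 yields n < 2^(S+8), and
-- 2^(5S') ≤ m^6 · c₂ for m = p₁⋯p_{k-1}, which yields 2^(S'+8) ≤ m² ≤ n when
-- p_k > √n (or trivially when S' ≤ 12, as n > 2^20).
module Submission where

open import Defs
open import Data.Nat
open import Data.Nat.Properties
open import Data.Nat.Logarithm
open import Data.Nat.Primality using (Prime; prime?)
open import Data.Nat.ListAction using (product; sum)
open import Data.Nat.ListAction.Properties using (product-++)
open import Data.List using (List; []; _∷_; _++_; [_]; _∷ʳ_; map)
open import Data.List.Properties using (map-id)
open import Data.List.Membership.Propositional using (_∈_; _∉_)
open import Data.List.Membership.Propositional.Properties using (∈-∃++)
open import Data.List.Membership.DecPropositional _≟_ using (_∈?_)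
open import Data.List.Relation.Unary.All using (All; []; _∷_; lookup; all?)
import Data.List.Relation.Unary.All.Properties as All
open import Data.List.Relation.Unary.Any using (here; there)
open import Data.List.Relation.Unary.Unique.Propositional using (Unique)
open import Data.List.Relation.Unary.AllPairs using ([]; _∷_)
open import Data.Product using (_×_; _,_)
open import Function using (_∘_)
open import Data.Unit using (tt)
open import Data.Empty using (⊥-elim)
open import Relation.Nullary using (yes; no)
open import Relation.Nullary.Decidable using (toWitness; _→-dec_; ¬?)
open import Relation.Unary using (Decidable)
open import Relation.Binary.PropositionalEquality
  using (_≡_; _≢_; refl; sym; trans; cong; subst; subst₂)
open import Algebra.Properties.CommutativeSemigroup *-commutativeSemigroup
  using (interchange; x∙yz≈y∙xz; x∙yz≈yx∙z; xy∙z≈y∙xz)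

m≤m∣∣1 : ∀ m → m ≤ m ∣∣1
m≤m∣∣1 m with m % 2
... | zero  = n≤1+n m
... | suc _ = ≤-refl

m∣∣1≤1+m : ∀ m → m ∣∣1 ≤ suc m
m∣∣1≤1+m m with m % 2
... | zero  = ≤-refl
... | suc _ = n≤1+n m

2^⌊log₂n⌋≤n : ∀ n → 1 ≤ n → 2 ^ ⌊log₂ n ⌋ ≤ n
2^⌊log₂n⌋≤n n = ⌊log₂n⌋≡k⇒2^k≤n _ n refl
  where
  ⌊log₂n⌋≡k⇒2^k≤n : ∀ k n → ⌊log₂ n ⌋ ≡ k → 1 ≤ n → 2 ^ k ≤ n
  ⌊log₂n⌋≡k⇒2^k≤n zero    n                 _  1≤n = 1≤n
  ⌊log₂n⌋≡k⇒2^k≤n (suc k) n@(suc (suc _)) eq _   = begin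
    2 * 2 ^ k               ≤⟨ *-monoʳ-≤ 2 (⌊log₂n⌋≡k⇒2^k≤n k ⌊ n /2⌋ log-half z<s) ⟩
    ⌊ n /2⌋ + (⌊ n /2⌋ + 0) ≡⟨ cong (⌊ n /2⌋ +_) (+-identityʳ _) ⟩
    ⌊ n /2⌋ + ⌊ n /2⌋       ≤⟨ +-monoʳ-≤ ⌊ n /2⌋ (⌊n/2⌋≤⌈n/2⌉ n) ⟩
    ⌊ n /2⌋ + ⌈ n /2⌉       ≡⟨ ⌊n/2⌋+⌈n/2⌉≡n n ⟩
    n                       ∎
    where
    open ≤-Reasoning
    log-half : ⌊log₂ ⌊ n /2⌋ ⌋ ≡ k
    log-half = trans (⌊log₂⌊n/2⌋⌋≡⌊log₂n⌋∸1 n) (cong (_∸ 1) eq)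

2^k≤n⇒k≤⌊log₂n⌋ : ∀ {k n} → 2 ^ k ≤ n → k ≤ ⌊log₂ n ⌋
2^k≤n⇒k≤⌊log₂n⌋ {k} 2^k≤n = subst (_≤ _) (⌊log₂[2^n]⌋≡n k) (⌊log₂⌋-mono-≤ 2^k≤n)

n<2^k⇒⌊log₂n⌋<k : ∀ {n k} → 1 ≤ n → n < 2 ^ k → ⌊log₂ n ⌋ < k
n<2^k⇒⌊log₂n⌋<k {n} {k} 1≤n n<2^k with k ≤? ⌊log₂ n ⌋
... | yes k≤log = ⊥-elim (<⇒≱ n<2^k (≤-trans (^-monoʳ-≤ 2 k≤log) (2^⌊log₂n⌋≤n n 1≤n)))
... | no  k≰log = ≰⇒> k≰log

n<2^[1+⌊log₂n⌋] : ∀ n → n < 2 ^ suc ⌊log₂ n ⌋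
n<2^[1+⌊log₂n⌋] n with 2 ^ suc ⌊log₂ n ⌋ ≤? n
... | yes 2^k≤n = ⊥-elim (n≮n _ (2^k≤n⇒k≤⌊log₂n⌋ 2^k≤n))
... | no  2^k≰n = ≰⇒> 2^k≰n

^-distribʳ-* : ∀ m n k → (m * n) ^ k ≡ m ^ k * n ^ k
^-distribʳ-* m n zero    = refl
^-distribʳ-* m n (suc k) = trans (cong (m * n *_) (^-distribʳ-* m n k))
                                 (interchange m n (m ^ k) (n ^ k))

^-cancelʳ-< : ∀ k {m n} → m ^ suc k < n ^ suc k → m < n
^-cancelʳ-< k {m} {n} lt with m <? n
... | yes m<n = m<n
... | no  m≮n = ⊥-elim (<⇒≱ lt (^-monoˡ-≤ (suc k) (≮⇒≥ m≮n)))

^-cancelʳ-≤ : ∀ k {m n} → m ^ suc k ≤ n ^ suc k → m ≤ n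
^-cancelʳ-≤ k {m} {n} le with m ≤? n
... | yes m≤n = m≤n
... | no  m≰n = ⊥-elim (<⇒≱ (^-monoˡ-< (suc k) (≰⇒> m≰n)) le)

-- Both a and b lie in the dyadic range [2^e, 2^(e+1)], and k ≤ e absorbs the
-- extra factor 2^k that b^k can gain over a^k.
^-≤-^suc-dyadic : ∀ {k e a b} → k ≤ e → 2 ^ e ≤ a → b ≤ 2 ^ suc e → b ^ k ≤ a ^ suc k
^-≤-^suc-dyadic {k} {e} {a} {b} k≤e 2^e≤a b≤2^[1+e] = begin
  b ^ k              ≤⟨ ^-monoˡ-≤ k b≤2^[1+e] ⟩
  (2 ^ suc e) ^ k    ≡⟨ ^-*-assoc 2 (suc e) k ⟩
  2 ^ (k + e * k)    ≤⟨ ^-monoʳ-≤ 2 (+-monoˡ-≤ (e * k) k≤e) ⟩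
  2 ^ (e + e * k)    ≡⟨ cong (2 ^_) (sym (*-suc e k)) ⟩
  2 ^ (e * suc k)    ≡⟨ ^-*-assoc 2 e (suc k) ⟨
  (2 ^ e) ^ suc k    ≤⟨ ^-monoˡ-≤ (suc k) 2^e≤a ⟩
  a ^ suc k          ∎
  where open ≤-Reasoning

weight : ℕ → ℕ
weight p = 2 ^ (⌊log₂ p ⌋ ∣∣1)

2^⌊log₂p⌋≤weight : ∀ p → 2 ^ ⌊log₂ p ⌋ ≤ weight p
2^⌊log₂p⌋≤weight p = ^-monoʳ-≤ 2 (m≤m∣∣1 ⌊log₂ p ⌋)

weight≤2^[1+⌊log₂p⌋] : ∀ p → weight p ≤ 2 ^ suc ⌊log₂ p ⌋
weight≤2^[1+⌊log₂p⌋] p = ^-monoʳ-≤ 2 (m∣∣1≤1+m ⌊log₂ p ⌋)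

-- The primes p < 2^7 with p^7 > weight p ^ 8, resp. p < 2^5 with
-- weight p ^ 5 > p^6; above these ranges the dyadic bound applies.
lowerExceptions upperExceptions : List ℕ
lowerExceptions = 3 ∷ 11 ∷ 13 ∷ 53 ∷ 59 ∷ 61 ∷ []
upperExceptions = 5 ∷ 17 ∷ []

p^7≤weight^8 : ∀ {p} → Prime p → p ∉ lowerExceptions → p ^ 7 ≤ weight p ^ 8
p^7≤weight^8 {p} p-prime p∉E with p <? 2 ^ 7
... | yes p<2^7 = toWitness {a? = allUpTo? good? (2 ^ 7)} tt p<2^7 p-prime p∉E
  where
  good? : Decidable (λ p → Prime p → p ∉ lowerExceptions → p ^ 7 ≤ weight p ^ 8)
  good? p = prime? p →-dec ¬? (p ∈? lowerExceptions) →-dec p ^ 7 ≤? weight p ^ 8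
... | no  p≮2^7 = ^-≤-^suc-dyadic (2^k≤n⇒k≤⌊log₂n⌋ {7} (≮⇒≥ p≮2^7))
                    (2^⌊log₂p⌋≤weight p) (<⇒≤ (n<2^[1+⌊log₂n⌋] p))

weight^5≤p^6 : ∀ {p} → Prime p → p ∉ upperExceptions → weight p ^ 5 ≤ p ^ 6
weight^5≤p^6 {p} p-prime p∉E with p <? 2 ^ 5
... | yes p<2^5 = toWitness {a? = allUpTo? good? (2 ^ 5)} tt p<2^5 p-prime p∉E
  where
  good? : Decidable (λ p → Prime p → p ∉ upperExceptions → weight p ^ 5 ≤ p ^ 6)
  good? p = prime? p →-dec ¬? (p ∈? upperExceptions) →-dec weight p ^ 5 ≤? p ^ 6
... | no  p≮2^5 = ^-≤-^suc-dyadic (2^k≤n⇒k≤⌊log₂n⌋ {5} (≮⇒≥ p≮2^5))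
                    (2^⌊log₂n⌋≤n p (≤-trans (s≤s z≤n) (≮⇒≥ p≮2^5))) (weight≤2^[1+⌊log₂p⌋] p)

∏ : (ℕ → ℕ) → List ℕ → ℕ
∏ f xs = product (map f xs)

∏-^ : ∀ f k xs → ∏ (λ x → f x ^ k) xs ≡ ∏ f xs ^ k
∏-^ f k []       = sym (^-zeroˡ k)
∏-^ f k (x ∷ xs) = trans (cong (f x ^ k *_) (∏-^ f k xs)) (sym (^-distribʳ-* (f x) (∏ f xs) k))

∏-^-sum : ∀ m f xs → ∏ (λ x → m ^ f x) xs ≡ m ^ sum (map f xs)
∏-^-sum m f []       = refl
∏-^-sum m f (x ∷ xs) = trans (cong (m ^ f x *_) (∏-^-sum m f xs)) (sym (^-distribˡ-+-* m (f x) _))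

∏-mono-≤ : ∀ {f g} xs → All (λ x → f x ≤ g x) xs → ∏ f xs ≤ ∏ g xs
∏-mono-≤ []       []         = ≤-refl
∏-mono-≤ (x ∷ xs) (fx≤gx ∷ le) = *-mono-≤ fx≤gx (∏-mono-≤ xs le)

∏-insert : ∀ f as x bs → ∏ f (as ++ x ∷ bs) ≡ f x * ∏ f (as ++ bs)
∏-insert f []       x bs = refl
∏-insert f (a ∷ as) x bs = trans (cong (f a *_) (∏-insert f as x bs)) (x∙yz≈y∙xz (f a) (f x) _)

∈-remove : ∀ {y x : ℕ} as bs → y ∈ as ++ x ∷ bs → y ≢ x → y ∈ as ++ bs
∈-remove []       bs (here refl)  y≢x = ⊥-elim (y≢x refl)
∈-remove []       bs (there y∈bs) _   = y∈bs
∈-remove (a ∷ as) bs (here refl)  _   = here refl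
∈-remove (a ∷ as) bs (there y∈)   y≢x = there (∈-remove as bs y∈ y≢x)

Unique-++⁻ˡ : ∀ (xs : List ℕ) {ys} → Unique (xs ++ ys) → Unique xs
Unique-++⁻ˡ []       _              = []
Unique-++⁻ˡ (x ∷ xs) (x∉xs++ys ∷ u) = All.++⁻ˡ xs x∉xs++ys ∷ Unique-++⁻ˡ xs u

-- Cross-multiplied form of: over distinct elements, ∏ f / ∏ g is at most its value over E.
∏-≤-up-to-exceptions : ∀ f g E {xs} → Unique xs →
  (∀ {x} → x ∈ xs → x ∉ E → f x ≤ g x) → All (λ e → g e ≤ f e) E →
  ∏ f xs * ∏ g E ≤ ∏ g xs * ∏ f E
∏-≤-up-to-exceptions f g E {[]} _ _ g≤f =
  *-monoʳ-≤ 1 (∏-mono-≤ E g≤f)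
∏-≤-up-to-exceptions f g E {x ∷ xs} (x∉xs ∷ unique) f≤g g≤f with x ∈? E
... | no x∉E = begin
  f x * ∏ f xs * ∏ g E   ≡⟨ *-assoc (f x) _ _ ⟩
  f x * (∏ f xs * ∏ g E) ≤⟨ *-mono-≤ (f≤g (here refl) x∉E) ih ⟩
  g x * (∏ g xs * ∏ f E) ≡⟨ *-assoc (g x) _ _ ⟨
  g x * ∏ g xs * ∏ f E   ∎
  where
  open ≤-Reasoning
  ih : ∏ f xs * ∏ g E ≤ ∏ g xs * ∏ f E
  ih = ∏-≤-up-to-exceptions f g E unique (f≤g ∘ there) g≤f
... | yes x∈E with ∈-∃++ x∈E
... | as , bs , refl = begin
  f x * ∏ f xs * ∏ g (as ++ x ∷ bs)     ≡⟨ cong (f x * ∏ f xs *_) (∏-insert g as x bs) ⟩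
  f x * ∏ f xs * (g x * ∏ g (as ++ bs)) ≡⟨ interchange (f x) _ (g x) _ ⟩
  f x * g x * (∏ f xs * ∏ g (as ++ bs)) ≤⟨ *-monoʳ-≤ (f x * g x) ih ⟩
  f x * g x * (∏ g xs * ∏ f (as ++ bs)) ≡⟨ cong (_* (∏ g xs * ∏ f (as ++ bs))) (*-comm (f x) (g x)) ⟩
  g x * f x * (∏ g xs * ∏ f (as ++ bs)) ≡⟨ interchange (g x) _ (f x) _ ⟨
  g x * ∏ g xs * (f x * ∏ f (as ++ bs)) ≡⟨ cong (g x * ∏ g xs *_) (∏-insert f as x bs) ⟨
  g x * ∏ g xs * ∏ f (as ++ x ∷ bs)     ∎
  where
  open ≤-Reasoning
  g≤f-rest : All (λ e → g e ≤ f e) (as ++ bs)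
  g≤f-rest with All.++⁻ as g≤f
  ... | g≤f-as , _ ∷ g≤f-bs = All.++⁺ g≤f-as g≤f-bs
  ih : ∏ f xs * ∏ g (as ++ bs) ≤ ∏ g xs * ∏ f (as ++ bs)
  ih = ∏-≤-up-to-exceptions f g (as ++ bs) unique
         (λ y∈xs y∉rest → f≤g (there y∈xs)
           (λ y∈E → y∉rest (∈-remove as bs y∈E (λ { refl → lookup x∉xs y∈xs refl }))))
         g≤f-rest

∏-id-^ : ∀ k xs → ∏ (λ x → x ^ k) xs ≡ product xs ^ k
∏-id-^ k xs = trans (∏-^ (λ x → x) k xs) (cong (λ ys → product ys ^ k) (map-id xs))

∏-weight-^ : ∀ k xs → ∏ (λ p → weight p ^ k) xs ≡ (2 ^ S xs) ^ k
∏-weight-^ k xs = trans (∏-^ weight k xs) (cong (_^ k) (∏-^-sum 2 _ xs))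

^-balance⇒< : ∀ k {n t q r c} .{{_ : NonZero t}} →
  n ^ k * q ≤ t ^ suc k * r → n * r < c ^ suc k * q → n < c * t
^-balance⇒< k {n} {t} {q} {r} {c} balance nr<cq = ^-cancelʳ-< k (*-cancelʳ-< _ _ _ chain)
  where
  open ≤-Reasoning
  chain : n ^ suc k * q < (c * t) ^ suc k * q
  chain = begin-strict
    n * n ^ k * q               ≡⟨ *-assoc n _ q ⟩
    n * (n ^ k * q)             ≤⟨ *-monoʳ-≤ n balance ⟩
    n * (t ^ suc k * r)         ≡⟨ x∙yz≈y∙xz n (t ^ suc k) r ⟩
    t ^ suc k * (n * r)         <⟨ *-monoʳ-< (t ^ suc k) {{m^n≢0 t (suc k)}} nr<cq ⟩
    t ^ suc k * (c ^ suc k * q) ≡⟨ x∙yz≈yx∙z (t ^ suc k) (c ^ suc k) q ⟩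
    c ^ suc k * t ^ suc k * q   ≡⟨ cong (_* q) (^-distribʳ-* c t (suc k)) ⟨
    (c * t) ^ suc k * q         ∎

n<2^[8+S] : ∀ {n} ps → All Prime ps → Unique ps → product ps ≡ n → n ≤ 10 ^ 16 →
  n < 2 ^ (8 + S ps)
n<2^[8+S] {n} ps primes unique refl n≤10^16 = subst (n <_) (sym (^-distribˡ-+-* 2 8 (S ps)))
  (^-balance⇒< 7 {c = 2 ^ 8} {{m^n≢0 2 (S ps)}} balance
    (≤-<-trans (*-monoˡ-≤ _ n≤10^16) defect))
  where
  E = lowerExceptions
  defect : 10 ^ 16 * ∏ (λ p → p ^ 7) E < (2 ^ 8) ^ 8 * ∏ (λ p → weight p ^ 8) E
  defect = ≤ᵇ⇒≤ _ _ tt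
  balance : n ^ 7 * ∏ (λ p → weight p ^ 8) E ≤ (2 ^ S ps) ^ 8 * ∏ (λ p → p ^ 7) E
  balance = subst₂ (λ a b → a * _ ≤ b * _) (∏-id-^ 7 ps) (∏-weight-^ 8 ps)
    (∏-≤-up-to-exceptions (λ p → p ^ 7) (λ p → weight p ^ 8) E unique
      (λ p∈ps → p^7≤weight^8 (lookup primes p∈ps))
      (toWitness {a? = all? (λ p → weight p ^ 8 ≤? p ^ 7) E} tt))

2^[8+S]≤product² : ∀ qs → All Prime qs → Unique qs → 13 ≤ S qs →
  2 ^ (8 + S qs) ≤ product qs * product qs
2^[8+S]≤product² qs primes unique 13≤s = ^-cancelʳ-≤ 2 (*-cancelʳ-≤ _ _ r (begin
  (2 ^ (8 + s)) ^ 3 * r     ≡⟨ cong (λ a → a ^ 3 * r) (^-distribˡ-+-* 2 8 s) ⟩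
  (2 ^ 8 * T) ^ 3 * r       ≡⟨ cong (_* r) (^-distribʳ-* (2 ^ 8) T 3) ⟩
  (2 ^ 8) ^ 3 * T ^ 3 * r   ≡⟨ xy∙z≈y∙xz ((2 ^ 8) ^ 3) (T ^ 3) r ⟩
  T ^ 3 * ((2 ^ 8) ^ 3 * r) ≤⟨ *-monoʳ-≤ (T ^ 3) (≤-trans defect (*-monoˡ-≤ q 2^26≤T²)) ⟩
  T ^ 3 * (T ^ 2 * q)       ≡⟨ *-assoc (T ^ 3) (T ^ 2) q ⟨
  T ^ 3 * T ^ 2 * q         ≡⟨ cong (_* q) (^-distribˡ-+-* T 3 2) ⟨
  T ^ 5 * q                 ≤⟨ balance ⟩
  m ^ 6 * r                 ≡⟨ cong (_* r) (^-distribˡ-+-* m 3 3) ⟩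
  m ^ 3 * m ^ 3 * r         ≡⟨ cong (_* r) (^-distribʳ-* m m 3) ⟨
  (m * m) ^ 3 * r           ∎))
  where
  open ≤-Reasoning
  E = upperExceptions
  s = S qs
  T = 2 ^ s
  m = product qs
  q = ∏ (λ p → p ^ 6) E
  r = ∏ (λ p → weight p ^ 5) E
  defect : (2 ^ 8) ^ 3 * r ≤ 2 ^ 26 * q
  defect = ≤ᵇ⇒≤ _ _ tt
  2^26≤T² : 2 ^ 26 ≤ T ^ 2
  2^26≤T² = subst (2 ^ 26 ≤_) (sym (^-*-assoc 2 s 2)) (^-monoʳ-≤ 2 (*-monoˡ-≤ 2 13≤s))
  balance : T ^ 5 * q ≤ m ^ 6 * r
  balance = subst₂ (λ a b → a * q ≤ b * r) (∏-weight-^ 5 qs) (∏-id-^ 6 qs)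
    (∏-≤-up-to-exceptions (λ p → weight p ^ 5) (λ p → p ^ 6) E unique
      (λ p∈qs → weight^5≤p^6 (lookup primes p∈qs))
      (toWitness {a? = all? (λ p → p ^ 6 ≤? weight p ^ 5) E} tt))

2^[8+S]≤n : ∀ {n} ps qs q → ps ≡ qs ∷ʳ q → All Prime ps → Unique ps → product ps ≡ n →
  n < q * q → 2 ^ 20 < n → 2 ^ (8 + S qs) ≤ n
2^[8+S]≤n _ qs q refl primes unique refl n<q² 2^20<n with S qs ≤? 12
... | yes s≤12 = ≤-trans (^-monoʳ-≤ 2 (+-monoʳ-≤ 8 s≤12)) (<⇒≤ 2^20<n)
... | no  s≰12 = begin
  2 ^ (8 + S qs)          ≤⟨ 2^[8+S]≤product² qs (All.++⁻ˡ qs primes) (Unique-++⁻ˡ qs unique)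
                                                 (≰⇒> s≰12) ⟩
  m * m                   ≤⟨ *-monoʳ-≤ m (<⇒≤ m<q) ⟩
  m * q                   ≡⟨ product-∷ʳ ⟨
  product (qs ∷ʳ q)       ∎
  where
  open ≤-Reasoning
  m = product qs
  product-∷ʳ : product (qs ∷ʳ q) ≡ m * q
  product-∷ʳ = trans (product-++ qs [ q ]) (cong (m *_) (*-identityʳ q))
  m<q : m < q
  m<q = *-cancelʳ-< _ _ _ (subst (_< q * q) product-∷ʳ n<q²)

theorem1 : (n : ℕ) → 2 ^ 20 < n → n ≤ 10 ^ 16 →
    (ps : List ℕ) → All Prime ps → Unique ps → product ps ≡ n →
    (S ps ≥ ⌊log₂ n ⌋ ∸ 7)
    × ((qs : List ℕ) → (q : ℕ) → ps ≡ qs ∷ʳ q → n < q * q →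
    S qs < ⌊log₂ n ⌋ ∸ 7)
theorem1 n 2^20<n n≤10^16 ps primes unique ∏ps≡n = lower , upper
  where
  lower : S ps ≥ ⌊log₂ n ⌋ ∸ 7
  lower = m≤n+o⇒m∸n≤o _ 7 (≤-pred (n<2^k⇒⌊log₂n⌋<k (≤-trans (s≤s z≤n) 2^20<n)
            (n<2^[8+S] ps primes unique ∏ps≡n n≤10^16)))
  upper : ∀ qs q → ps ≡ qs ∷ʳ q → n < q * q → S qs < ⌊log₂ n ⌋ ∸ 7
  upper qs q ps≡ n<q² = ∸-monoˡ-≤ 7 (2^k≤n⇒k≤⌊log₂n⌋ {8 + S qs}
    (2^[8+S]≤n ps qs q ps≡ primes unique ∏ps≡n n<q² 2^20<n))
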